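{- Let $r\geq2$, $m\geq1$, let $V$ be a vector subspace of $\mathbb{Q}^m$, let $A=a+V$ (with $a\in\mathbb{Q}^m$) be an affine space of direction $V$, and let $s\in\{0,r-1\}^m$ be such that $V\subseteq\vec{\mathrm{saff}}(Z_{r,m,s}\cap A)$. Then there exists a vector $v\in V$ such that, for every $i\in\{1,\dots,m\}$ with $\mathbf{e}_{i,m}\notin V^\perp$, we have $v[i]<0$ if $s[i]=r-1$ and $v[i]>0$ if $s[i]=0$.
   Context: $Z_{r,m,s}=\{x\in\mathbb{Z}^m: x[i]\geq0 \text{ if } s[i]=0,\ x[i]<0 \text{ if } s[i]=r-1\}$. $\mathbf{e}_{i,m}$ is the $i$-th standard unit vector of $\mathbb{Q}^m$, and $V^\perp$ is the orthogonal complement of $V$ in $\mathbb{Q}^m$ for the standard inner product. Semi-affine notions: a semi-affine space is a finite union of affine subspaces of $\mathbb{Q}^m$; $\mathrm{saff}(Y)$ is the smallest semi-affine space containing $Y$; its affine components are the maximal affine spaces it contains; $\vec{\mathrm{saff}}(Y)$ is the union of the directions of the affine components of $\mathrm{saff}(Y)$. (In the paper the hypothesis is written $[Z_{r,m,s}\cap A]^V\neq[\emptyset]^V$, where $Y_1\sim^V Y_2$ iff $V\not\subseteq\vec{\mathrm{saff}}(Y_1\,\Delta\, Y_2)$; this is equivalent to $V\subseteq\vec{\mathrm{saff}}(Z_{r,m,s}\cap A)$.) -}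

module Defs where

open import Data.Nat using (ℕ; zero; suc; _∸_)
open import Data.Integer using (ℤ)
open import Data.Rational using (ℚ; 0ℚ; 1ℚ; _+_; _*_; _-_; _<_; _≤_; _/_)
open import Data.Fin using (Fin; zero; suc; _≟_)
open import Data.List using (List)
open import Data.List.Relation.Unary.Any using (Any)
open import Data.Product using (Σ; ∃; _×_; _,_; proj₁; proj₂)
open import Relation.Binary.PropositionalEquality using (_≡_)
open import Relation.Nullary using (¬_; yes; no)

Vecℚ : ℕ → Set
Vecℚ m = Fin m → ℚ

Subset : ℕ → Set₁
Subset m = Vecℚ m → Set

_⊆_ : ∀ {m} → Subset m → Subset m → Set
P ⊆ Q = ∀ x → P x → Q x

_∩_ : ∀ {m} → Subset m → Subset m → Subset m
(P ∩ Q) x = P x × Q x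

_≐_ : ∀ {m} → Vecℚ m → Vecℚ m → Set
u ≐ v = ∀ i → u i ≡ v i

_⊕_ : ∀ {m} → Vecℚ m → Vecℚ m → Vecℚ m
(u ⊕ v) i = u i + v i

sumFin : ∀ {k} → (Fin k → ℚ) → ℚ
sumFin {zero} f = 0ℚ
sumFin {suc k} f = f zero + sumFin (λ j → f (suc j))

Gens : ℕ → Set
Gens m = Σ ℕ (λ k → Fin k → Vecℚ m)

-- linear span of a finite family of vectors.  Every vector subspace of ℚ^m
-- is the span of a finite family, so subspaces are represented this way.
Span : ∀ {m} → Gens m → Subset m
Span {m} (k , g) v = Σ (Fin k → ℚ) λ c → v ≐ (λ i → sumFin (λ j → c j * g j i))

AffData : ℕ → Set
AffData m = Vecℚ m × Gens m

⟦_⟧A : ∀ {m} → AffData m → Subset m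
⟦ p , gs ⟧A x = Σ (Vecℚ _) λ v → Span gs v × (x ≐ (p ⊕ v))

dir : ∀ {m} → AffData m → Subset m
dir (p , gs) = Span gs

-- semi-affine space: finite union of affine subspaces
⟦_⟧S : ∀ {m} → List (AffData m) → Subset m
⟦ L ⟧S x = Any (λ C → ⟦ C ⟧A x) L

IsSaff : ∀ {m} → Subset m → List (AffData m) → Set
IsSaff {m} Y L = (Y ⊆ ⟦ L ⟧S) × (∀ (L' : List (AffData m)) → Y ⊆ ⟦ L' ⟧S → ⟦ L ⟧S ⊆ ⟦ L' ⟧S)

IsComponent : ∀ {m} → List (AffData m) → AffData m → Set
IsComponent {m} L C = (⟦ C ⟧A ⊆ ⟦ L ⟧S)
  × (∀ (C' : AffData m) → ⟦ C ⟧A ⊆ ⟦ C' ⟧A → ⟦ C' ⟧A ⊆ ⟦ L ⟧S → ⟦ C' ⟧A ⊆ ⟦ C ⟧A)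

vsaff : ∀ {m} → Subset m → Subset m
vsaff {m} Y v = Σ (List (AffData m)) λ L → IsSaff Y L
  × Σ (AffData m) λ C → IsComponent L C × dir C v

IsInt : ℚ → Set
IsInt q = Σ ℤ λ z → q ≡ z / 1

Z : (r m : ℕ) → (Fin m → ℕ) → Subset m
Z r m s x = ∀ i → IsInt (x i)
  × (s i ≡ 0 → 0ℚ ≤ x i)
  × (s i ≡ r ∸ 1 → x i < 0ℚ)

affine : ∀ {m} → Vecℚ m → Gens m → Subset m
affine a V = ⟦ a , V ⟧A

dot : ∀ {m} → Vecℚ m → Vecℚ m → ℚ
dot u v = sumFin (λ i → u i * v i)

e : ∀ {m} → Fin m → Vecℚ m
e i j with i ≟ j
... | yes _ = 1ℚ
... | no _ = 0ℚ

Perp : ∀ {m} → Subset m → Subset m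
Perp V w = ∀ x → V x → dot w x ≡ 0ℚ

{-# OPTIONS --safe #-}
module Submission where

-- If eᵢ is not orthogonal to V, the i-th coordinate is unbounded on Y = Z ∩ A in the
-- direction prescribed by s.  Otherwise the integers y[i] (y ∈ Y) take finitely many values,
-- so Y, hence saff Y and each of its components, lies in finitely many hyperplanes x[i] = c;
-- a component then contains no line whose direction x has x[i] ≠ 0, and V ⊆ vsaff Y forces
-- x[i] = 0 on V.  Now pick y₀ ∈ Y (nonempty, as saff Y has a component) and, for each such i,
-- yᵢ ∈ Y with σᵢ·yᵢ[i] > m·σᵢ·y₀[i], where σ is the sign prescribed by s.  Every y ∈ Y has
-- σⱼ·y[j] ≥ 0, so v = Σᵢ (yᵢ − y₀) ∈ V has σⱼ·v[j] > 0 wherever required.  These choices are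
-- not effective and only refute the nonexistence of v; but whether such a v exists is
-- decidable by Fourier–Motzkin elimination, which produces one.

open import Defs
open import Data.Nat using (ℕ; _≥_; _∸_)
open import Data.Fin using (Fin)
open import Data.Rational using (0ℚ; _<_)
open import Data.Product using (Σ; _×_)
open import Data.Sum using (_⊎_)
open import Relation.Binary.PropositionalEquality using (_≡_)
open import Relation.Nullary using (¬_)

open import Data.Fin as Fin using (zero; suc)
open import Data.Fin.Properties using (suc-injective; all?)
open import Data.Integer using (-[1+_])
import Data.Integer as ℤ
import Data.Integer.Properties as ℤ
open import Data.List using (List; []; _∷_; map; _++_; applyUpTo; filter; allFin; cartesianProductWith)
open import Data.List.Membership.Propositional using (_∈_; _∉_)
open import Data.List.Membership.Propositional.Properties
  using (∈-map⁺; ∈-map⁻; ∈-++⁺ˡ; ∈-++⁺ʳ; ∈-applyUpTo⁺; ∈-filter⁺; ∈-filter⁻; ∈-allFin;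
         ∈-cartesianProductWith⁺)
open import Data.List.Relation.Unary.All as All using (All; []; _∷_)
import Data.List.Relation.Unary.All.Properties as All
import Data.List.Relation.Unary.Any as Any
import Data.List.Relation.Unary.Any.Properties as Any
import Data.Nat as ℕ
import Data.Nat.Coprimality as Coprimality
import Data.Nat.Properties as ℕ
open import Data.Product using (_,_; proj₁; proj₂)
open import Data.Rational
  using (ℚ; 1ℚ; _+_; _*_; _-_; -_; _≤_; _/_; 1/_; mkℚ; ↥_; *≤*;
         NonZero; ≢-nonZero; positive; negative; nonNegative; nonPositive)
open import Data.Rational.Properties
open import Data.Sum using (inj₁; inj₂)
open import Data.Vec.Functional using (head; tail)
import Data.Vec.Functional as Vector
open import Effect.Monad using (RawMonad)
open import Function using (_∘_; id; _⇔_; mk⇔; Equivalence)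
open import Function.Construct.Composition using (_⇔-∘_)
open import Level using (0ℓ)
open import Relation.Binary.Bundles using (DecTotalOrder)
open import Relation.Binary.Definitions using (tri<; tri≈; tri>)
open import Relation.Binary.PropositionalEquality
  using (setoid; refl; sym; trans; cong; cong₂; subst; subst₂; _≢_; module ≡-Reasoning)
open import Relation.Nullary using (Dec; yes; no; ¬?; contradiction)
open import Relation.Nullary.Decidable using (map′; decidable-stable; dec⇒maybe)
open import Relation.Nullary.Negation using (¬¬-Monad; ¬¬-map)
open import Tactic.RingSolver using (solve-∀)
open import Tactic.RingSolver.Core.AlmostCommutativeRing using (AlmostCommutativeRing; fromCommutativeRing)
import Algebra.Properties.Group as GroupProperties
import Algebra.Properties.Ring as RingProperties
import Data.List.Extrema as Extrema

open GroupProperties +-0-group using (⁻¹-involutive)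
open RingProperties +-*-ring using (-1*x≈-x; x[y-z]≈xy-xz)
open Extrema (DecTotalOrder.totalOrder ≤-decTotalOrder) using (max; min; xs≤max; min≤xs; argmax-sel; argmin-sel)

ℚ-ring : AlmostCommutativeRing 0ℓ 0ℓ
ℚ-ring = fromCommutativeRing +-*-commutativeRing (λ x → dec⇒maybe (0ℚ ≟ x))

sumFin-cong : ∀ {k} {f g : Fin k → ℚ} → (∀ j → f j ≡ g j) → sumFin f ≡ sumFin g
sumFin-cong {ℕ.zero} f≗g = refl
sumFin-cong {ℕ.suc k} f≗g = cong₂ _+_ (f≗g zero) (sumFin-cong (f≗g ∘ suc))

sumFin-zero : ∀ {k} {f : Fin k → ℚ} → (∀ j → f j ≡ 0ℚ) → sumFin f ≡ 0ℚ
sumFin-zero {ℕ.zero} f≗0 = refl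
sumFin-zero {ℕ.suc k} f≗0 = trans (cong₂ _+_ (f≗0 zero) (sumFin-zero (f≗0 ∘ suc))) (+-identityˡ 0ℚ)

sumFin-distrib-+ : ∀ {k} (f g : Fin k → ℚ) → sumFin (λ j → f j + g j) ≡ sumFin f + sumFin g
sumFin-distrib-+ {ℕ.zero} f g = refl
sumFin-distrib-+ {ℕ.suc k} f g =
  trans (cong ((f zero + g zero) +_) (sumFin-distrib-+ (f ∘ suc) (g ∘ suc)))
        (interchange (f zero) (g zero) (sumFin (f ∘ suc)) (sumFin (g ∘ suc)))
  where
  interchange : ∀ a b c d → (a + b) + (c + d) ≡ (a + c) + (b + d)
  interchange = solve-∀ ℚ-ring

sumFin-distrib-- : ∀ {k} (f g : Fin k → ℚ) → sumFin (λ j → f j - g j) ≡ sumFin f - sumFin g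
sumFin-distrib-- {ℕ.zero} f g = refl
sumFin-distrib-- {ℕ.suc k} f g =
  trans (cong ((f zero - g zero) +_) (sumFin-distrib-- (f ∘ suc) (g ∘ suc)))
        (interchange (f zero) (g zero) (sumFin (f ∘ suc)) (sumFin (g ∘ suc)))
  where
  interchange : ∀ a b c d → (a - b) + (c - d) ≡ (a + c) - (b + d)
  interchange = solve-∀ ℚ-ring

*-distribˡ-sumFin : ∀ {k} (a : ℚ) (f : Fin k → ℚ) → a * sumFin f ≡ sumFin (λ j → a * f j)
*-distribˡ-sumFin {ℕ.zero} a f = *-zeroʳ a
*-distribˡ-sumFin {ℕ.suc k} a f =
  trans (*-distribˡ-+ a (f zero) (sumFin (f ∘ suc))) (cong (a * f zero +_) (*-distribˡ-sumFin a (f ∘ suc)))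

0≤sumFin : ∀ {k} {f : Fin k → ℚ} → (∀ j → 0ℚ ≤ f j) → 0ℚ ≤ sumFin f
0≤sumFin {ℕ.zero} 0≤f = ≤-refl
0≤sumFin {ℕ.suc k} 0≤f = +-mono-≤ (0≤f zero) (0≤sumFin (0≤f ∘ suc))

term≤sumFin : ∀ {k} {f : Fin k → ℚ} → (∀ j → 0ℚ ≤ f j) → ∀ l → f l ≤ sumFin f
term≤sumFin {f = f} 0≤f zero = begin
  f zero                     ≡⟨ +-identityʳ (f zero) ⟨
  f zero + 0ℚ                ≤⟨ +-monoʳ-≤ (f zero) (0≤sumFin (0≤f ∘ suc)) ⟩
  f zero + sumFin (f ∘ suc)  ∎
  where open ≤-Reasoning
term≤sumFin {f = f} 0≤f (suc l) = begin
  f (suc l)                  ≤⟨ term≤sumFin (0≤f ∘ suc) l ⟩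
  sumFin (f ∘ suc)           ≡⟨ +-identityˡ (sumFin (f ∘ suc)) ⟨
  0ℚ + sumFin (f ∘ suc)      ≤⟨ +-monoˡ-≤ (sumFin (f ∘ suc)) (0≤f zero) ⟩
  f zero + sumFin (f ∘ suc)  ∎
  where open ≤-Reasoning

e-diag : ∀ {m} (i : Fin m) → e i i ≡ 1ℚ
e-diag i with i Fin.≟ i
... | yes _ = refl
... | no i≢i = contradiction refl i≢i

e-offdiag : ∀ {m} {i j : Fin m} → i ≢ j → e i j ≡ 0ℚ
e-offdiag {i = i} {j} i≢j with i Fin.≟ j
... | yes i≡j = contradiction i≡j i≢j
... | no _ = refl

e-offdiag-* : ∀ {m} {i j : Fin m} (x : ℚ) → i ≢ j → e i j * x ≡ 0ℚ
e-offdiag-* x i≢j = trans (cong (_* x) (e-offdiag i≢j)) (*-zeroˡ x)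

e-suc : ∀ {m} (i j : Fin m) → e (suc i) (suc j) ≡ e i j
e-suc i j = by-cases (i Fin.≟ j)
  where
  by-cases : Dec (i ≡ j) → e (suc i) (suc j) ≡ e i j
  by-cases (yes refl) = trans (e-diag (suc i)) (sym (e-diag i))
  by-cases (no i≢j) = trans (e-offdiag (i≢j ∘ suc-injective)) (sym (e-offdiag i≢j))

sumFin-e : ∀ {k} (l : Fin k) (f : Fin k → ℚ) → sumFin (λ j → e l j * f j) ≡ f l
sumFin-e {ℕ.suc k} zero f = begin
  e {ℕ.suc k} zero zero * f zero + sumFin (λ j → e zero (suc j) * f (suc j))
    ≡⟨ cong₂ _+_ (cong (_* f zero) (e-diag {ℕ.suc k} zero))
                 (sumFin-zero λ j → e-offdiag-* {i = zero} {suc j} (f (suc j)) λ ()) ⟩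
  1ℚ * f zero + 0ℚ
    ≡⟨ trans (+-identityʳ _) (*-identityˡ (f zero)) ⟩
  f zero ∎
  where open ≡-Reasoning
sumFin-e (suc l) f = begin
  e (suc l) zero * f zero + sumFin (λ j → e (suc l) (suc j) * f (suc j))
    ≡⟨ cong₂ _+_ (e-offdiag-* {i = suc l} {zero} (f zero) λ ())
                 (sumFin-cong λ j → cong (_* f (suc j)) (e-suc l j)) ⟩
  0ℚ + sumFin (λ j → e l j * f (suc j))
    ≡⟨ +-identityˡ _ ⟩
  sumFin (λ j → e l j * f (suc j))
    ≡⟨ sumFin-e l (f ∘ suc) ⟩
  f (suc l) ∎
  where open ≡-Reasoning

dot-e : ∀ {m} (i : Fin m) (x : Vecℚ m) → dot (e i) x ≡ x i
dot-e = sumFin-e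

_⊖_ : ∀ {k} → Vecℚ k → Vecℚ k → Vecℚ k
(u ⊖ w) j = u j - w j

*-distribʳ-- : ∀ s t u → (s - t) * u ≡ s * u - t * u
*-distribʳ-- = solve-∀ ℚ-ring

dot-scaleˡ : ∀ {k} (t : ℚ) (a c : Vecℚ k) → dot (λ j → t * a j) c ≡ t * dot a c
dot-scaleˡ t a c = trans (sumFin-cong λ j → *-assoc t (a j) (c j)) (sym (*-distribˡ-sumFin t (λ j → a j * c j)))

dot-⊖ : ∀ {k} (a b c : Vecℚ k) → dot (a ⊖ b) c ≡ dot a c - dot b c
dot-⊖ a b c =
  trans (sumFin-cong λ j → *-distribʳ-- (a j) (b j) (c j)) (sumFin-distrib-- (λ j → a j * c j) (λ j → b j * c j))

span-0 : ∀ {m} (V : Gens m) → Span V (λ _ → 0ℚ)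
span-0 (k , g) = (λ _ → 0ℚ) , λ i → sym (sumFin-zero λ j → *-zeroˡ (g j i))

span-+ : ∀ {m} {V : Gens m} {u w : Vecℚ m} → Span V u → Span V w → Span V (u ⊕ w)
span-+ {V = k , g} {u} {w} (c , u≐) (d , w≐) = (λ j → c j + d j) , λ i → begin
  u i + w i
    ≡⟨ cong₂ _+_ (u≐ i) (w≐ i) ⟩
  sumFin (λ j → c j * g j i) + sumFin (λ j → d j * g j i)
    ≡⟨ sumFin-distrib-+ (λ j → c j * g j i) (λ j → d j * g j i) ⟨
  sumFin (λ j → c j * g j i + d j * g j i)
    ≡⟨ sumFin-cong (λ j → *-distribʳ-+ (g j i) (c j) (d j)) ⟨
  sumFin (λ j → (c j + d j) * g j i) ∎
  where open ≡-Reasoning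

span-scale : ∀ {m} {V : Gens m} (t : ℚ) {u : Vecℚ m} → Span V u → Span V (λ i → t * u i)
span-scale {V = k , g} t {u} (c , u≐) = (λ j → t * c j) , λ i → begin
  t * u i                            ≡⟨ cong (t *_) (u≐ i) ⟩
  t * sumFin (λ j → c j * g j i)     ≡⟨ *-distribˡ-sumFin t (λ j → c j * g j i) ⟩
  sumFin (λ j → t * (c j * g j i))   ≡⟨ sumFin-cong (λ j → *-assoc t (c j) (g j i)) ⟨
  sumFin (λ j → t * c j * g j i)     ∎
  where open ≡-Reasoning

span-gen : ∀ {m} (V : Gens m) (j : Fin (proj₁ V)) → Span V (proj₂ V j)
span-gen (k , g) j = e j , λ i → sym (sumFin-e j (λ l → g l i))

span-sumFin : ∀ {m n} {V : Gens m} (w : Fin n → Vecℚ m) → (∀ i → Span V (w i))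
  → Span V (λ l → sumFin (λ i → w i l))
span-sumFin {n = ℕ.zero} {V} w w∈V = span-0 V
span-sumFin {n = ℕ.suc n} w w∈V = span-+ (w∈V zero) (span-sumFin (w ∘ suc) (w∈V ∘ suc))

affine-diff : ∀ {m} {a : Vecℚ m} {V : Gens m} {x y : Vecℚ m}
  → affine a V x → affine a V y → Span V (x ⊖ y)
affine-diff {a = a} {k , g} {x} {y} (v , (c , v≐) , x≐) (w , (d , w≐) , y≐) = (λ j → c j - d j) , λ l → begin
  x l - y l
    ≡⟨ cong₂ _-_ (x≐ l) (y≐ l) ⟩
  (a l + v l) - (a l + w l)
    ≡⟨ cancel (a l) (v l) (w l) ⟩
  v l - w l
    ≡⟨ cong₂ _-_ (v≐ l) (w≐ l) ⟩
  sumFin (λ j → c j * g j l) - sumFin (λ j → d j * g j l)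
    ≡⟨ sumFin-distrib-- (λ j → c j * g j l) (λ j → d j * g j l) ⟨
  sumFin (λ j → c j * g j l - d j * g j l)
    ≡⟨ sumFin-cong (λ j → *-distribʳ-- (c j) (d j) (g j l)) ⟨
  sumFin (λ j → (c j - d j) * g j l) ∎
  where
  open ≡-Reasoning
  cancel : ∀ p s t → (p + s) - (p + t) ≡ s - t
  cancel = solve-∀ ℚ-ring

e-perp? : ∀ {m} (V : Gens m) (i : Fin m) → Dec (Perp (Span V) (e i))
e-perp? V@(k , g) i = map′ gens⇒perp perp⇒gens (all? λ j → g j i ≟ 0ℚ)
  where
  gens⇒perp : (∀ j → g j i ≡ 0ℚ) → Perp (Span V) (e i)
  gens⇒perp gᵢ≡0 x (c , x≐) = begin
    dot (e i) x                 ≡⟨ dot-e i x ⟩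
    x i                         ≡⟨ x≐ i ⟩
    sumFin (λ j → c j * g j i)  ≡⟨ sumFin-zero (λ j → trans (cong (c j *_) (gᵢ≡0 j)) (*-zeroʳ (c j))) ⟩
    0ℚ                          ∎
    where open ≡-Reasoning
  perp⇒gens : Perp (Span V) (e i) → ∀ j → g j i ≡ 0ℚ
  perp⇒gens e⊥V j = trans (sym (dot-e i (g j))) (e⊥V (g j) (span-gen V j))

-- Semi-affine hulls

hyperplane : ∀ {m} → Fin m → ℚ → AffData m
hyperplane {m} i c = (λ l → e i l * c) , (m , λ j l → (1ℚ - e i l) * e l j)

hyperplane-combination : ∀ {m} (i : Fin m) (d : Vecℚ m) (l : Fin m)
  → sumFin (λ j → d j * ((1ℚ - e i l) * e l j)) ≡ (1ℚ - e i l) * d l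
hyperplane-combination i d l = begin
  sumFin (λ j → d j * ((1ℚ - e i l) * e l j))  ≡⟨ sumFin-cong (λ j → rearrange (d j) (1ℚ - e i l) (e l j)) ⟩
  sumFin (λ j → (1ℚ - e i l) * (e l j * d j))  ≡⟨ *-distribˡ-sumFin (1ℚ - e i l) (λ j → e l j * d j) ⟨
  (1ℚ - e i l) * sumFin (λ j → e l j * d j)    ≡⟨ cong ((1ℚ - e i l) *_) (sumFin-e l d) ⟩
  (1ℚ - e i l) * d l                           ∎
  where
  open ≡-Reasoning
  rearrange : ∀ x y z → x * (y * z) ≡ y * (z * x)
  rearrange = solve-∀ ℚ-ring

e-blend-diag : ∀ {m} (i : Fin m) (c y : ℚ) → e i i * c + (1ℚ - e i i) * y ≡ c
e-blend-diag i c y = trans (cong (λ t → t * c + (1ℚ - t) * y) (e-diag i)) (blend c y)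
  where
  blend : ∀ c y → 1ℚ * c + (1ℚ - 1ℚ) * y ≡ c
  blend = solve-∀ ℚ-ring

e-blend-offdiag : ∀ {m} {i l : Fin m} (c y : ℚ) → i ≢ l → e i l * c + (1ℚ - e i l) * y ≡ y
e-blend-offdiag c y i≢l = trans (cong (λ t → t * c + (1ℚ - t) * y) (e-offdiag i≢l)) (blend c y)
  where
  blend : ∀ c y → 0ℚ * c + (1ℚ - 0ℚ) * y ≡ y
  blend = solve-∀ ℚ-ring

∈-hyperplane⁺ : ∀ {m} {i : Fin m} {c : ℚ} {x : Vecℚ m} → x i ≡ c → ⟦ hyperplane i c ⟧A x
∈-hyperplane⁺ {i = i} {c} {x} xᵢ≡c =
  (λ l → (1ℚ - e i l) * x l) , (x , λ l → sym (hyperplane-combination i x l)) , λ l → sym (blend l (i Fin.≟ l))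
  where
  blend : ∀ l → Dec (i ≡ l) → e i l * c + (1ℚ - e i l) * x l ≡ x l
  blend l (yes refl) = trans (e-blend-diag i c (x i)) (sym xᵢ≡c)
  blend l (no i≢l) = e-blend-offdiag c (x l) i≢l

∈-hyperplane⁻ : ∀ {m} {i : Fin m} {c : ℚ} {x : Vecℚ m} → ⟦ hyperplane i c ⟧A x → x i ≡ c
∈-hyperplane⁻ {i = i} {c} {x} (v , (d , v≐) , x≐) = begin
  x i                               ≡⟨ x≐ i ⟩
  e i i * c + v i                   ≡⟨ cong (e i i * c +_) (trans (v≐ i) (hyperplane-combination i d i)) ⟩
  e i i * c + (1ℚ - e i i) * d i    ≡⟨ e-blend-diag i c (d i) ⟩
  c                                 ∎
  where open ≡-Reasoning

∈-hyperplanes⁺ : ∀ {m} {i : Fin m} {cs : List ℚ} {x : Vecℚ m} → x i ∈ cs → ⟦ map (hyperplane i) cs ⟧S x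
∈-hyperplanes⁺ {i = i} = Any.map⁺ ∘ Any.map (∈-hyperplane⁺ {i = i})

∈-hyperplanes⁻ : ∀ {m} {i : Fin m} {cs : List ℚ} {x : Vecℚ m} → ⟦ map (hyperplane i) cs ⟧S x → x i ∈ cs
∈-hyperplanes⁻ {i = i} = Any.map (∈-hyperplane⁻ {i = i}) ∘ Any.map⁻

p<p+1 : ∀ p → p < p + 1ℚ
p<p+1 p = subst (_< p + 1ℚ) (+-identityʳ p) (+-monoʳ-< p (positive⁻¹ 1ℚ))

fresh : (cs : List ℚ) → Σ ℚ (_∉ cs)
fresh cs = max 0ℚ cs + 1ℚ , λ c∈cs →
  <-irrefl refl (<-≤-trans (p<p+1 (max 0ℚ cs)) (All.lookup (xs≤max 0ℚ cs) c∈cs))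

solve-linear : ∀ p c x .{{_ : NonZero x}} → p + (c - p) * 1/ x * x ≡ c
solve-linear p c x = begin
  p + (c - p) * 1/ x * x    ≡⟨ cong (p +_) (*-assoc (c - p) (1/ x) x) ⟩
  p + (c - p) * (1/ x * x)  ≡⟨ cong (λ t → p + (c - p) * t) (*-inverseˡ x) ⟩
  p + (c - p) * 1ℚ          ≡⟨ cancel p c ⟩
  c                         ∎
  where
  open ≡-Reasoning
  cancel : ∀ p c → p + (c - p) * 1ℚ ≡ c
  cancel = solve-∀ ℚ-ring

base∈affine : ∀ {m} (p : Vecℚ m) (gs : Gens m) → ⟦ p , gs ⟧A p
base∈affine p gs = (λ _ → 0ℚ) , span-0 gs , λ l → sym (+-identityʳ (p l))

vsaff⇒¬¬inhabited : ∀ {m} {Y : Subset m} {x : Vecℚ m} → vsaff Y x → ¬ ¬ Σ (Vecℚ m) Y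
vsaff⇒¬¬inhabited (L , (_ , L-least) , (p , gs) , (C⊆L , _) , _) Y-empty =
  Any.¬Any[] (L-least [] (λ y Yy → contradiction (y , Yy) Y-empty) p (C⊆L p (base∈affine p gs)))

finitely-valued⇒vsaff-coordinate≡0 : ∀ {m} {Y : Subset m} (i : Fin m) (cs : List ℚ)
  → (∀ y → Y y → y i ∈ cs) → ∀ x → vsaff Y x → x i ≡ 0ℚ
finitely-valued⇒vsaff-coordinate≡0 {Y = Y} i cs Y∈cs x (L , (_ , L-least) , (p , gs) , (C⊆L , _) , x∈dir)
  with x i ≟ 0ℚ
... | yes xᵢ≡0 = xᵢ≡0
... | no xᵢ≢0 = contradiction (subst (_∈ cs) (solve-linear (p i) c (x i)) (line∈cs t)) (proj₂ (fresh cs))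
  where
  instance
    xᵢ-nonZero : NonZero (x i)
    xᵢ-nonZero = ≢-nonZero xᵢ≢0
  L⊆hyperplanes : ⟦ L ⟧S ⊆ ⟦ map (hyperplane i) cs ⟧S
  L⊆hyperplanes = L-least (map (hyperplane i) cs) (λ y Yy → ∈-hyperplanes⁺ (Y∈cs y Yy))
  line∈cs : ∀ t → p i + t * x i ∈ cs
  line∈cs t = ∈-hyperplanes⁻ (L⊆hyperplanes _ (C⊆L _ ((λ l → t * x l) , span-scale t x∈dir , λ l → refl)))
  c : ℚ
  c = proj₁ (fresh cs)
  t : ℚ
  t = (c - p i) * 1/ x i

+n/1≡mkℚ : ∀ n → ℤ.+ n / 1 ≡ mkℚ (ℤ.+ n) 0 (Coprimality.sym (Coprimality.1-coprimeTo n))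
+n/1≡mkℚ n = normalize-coprime (Coprimality.sym (Coprimality.1-coprimeTo n))

+n/1-cancel-≤ : ∀ {m n} → ℤ.+ m / 1 ≤ ℤ.+ n / 1 → m ℕ.≤ n
+n/1-cancel-≤ {m} {n} m≤n = ℤ.drop‿+≤+ (subst₂ ℤ._≤_ (ℤ.*-identityʳ (ℤ.+ m)) (ℤ.*-identityʳ (ℤ.+ n))
  (drop-*≤* (subst₂ _≤_ (+n/1≡mkℚ m) (+n/1≡mkℚ n) m≤n)))

≤-∣numerator∣ : ∀ q → q ≤ ℤ.+ ℤ.∣ ↥ q ∣ / 1
≤-∣numerator∣ q@(mkℚ (ℤ.+ n) d _) = subst (q ≤_) (sym (+n/1≡mkℚ n)) (*≤* (begin
  ℤ.+ n ℤ.* ℤ.+ 1          ≡⟨ ℤ.*-identityʳ (ℤ.+ n) ⟩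
  ℤ.+ n                    ≤⟨ ℤ.+≤+ (ℕ.m≤m*n n (ℕ.suc d)) ⟩
  ℤ.+ (n ℕ.* ℕ.suc d)      ≡⟨ ℤ.pos-* n (ℕ.suc d) ⟩
  ℤ.+ n ℤ.* ℤ.+ ℕ.suc d    ∎))
  where open ℤ.≤-Reasoning
≤-∣numerator∣ q@(mkℚ -[1+ n ] d _) = ≤-trans (*≤* ℤ.-≤+) (nonNegative⁻¹ _ {{normalize-nonNeg (ℕ.suc n) 1}})

integers-within : ℕ → List ℚ
integers-within B = applyUpTo (λ n → ℤ.+ n / 1) (ℕ.suc B) ++ applyUpTo (λ n → - (ℤ.+ n / 1)) (ℕ.suc B)

IsInt⇒∈-integers-within : ∀ {x} B → IsInt x → - (ℤ.+ B / 1) ≤ x → x ≤ ℤ.+ B / 1 → x ∈ integers-within B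
IsInt⇒∈-integers-within B (ℤ.+ n , refl) _ x≤B =
  ∈-++⁺ˡ (∈-applyUpTo⁺ (λ n → ℤ.+ n / 1) {n} {ℕ.suc B} (ℕ.s≤s (+n/1-cancel-≤ x≤B)))
IsInt⇒∈-integers-within B (-[1+ n ] , refl) -B≤x _ =
  ∈-++⁺ʳ (applyUpTo (λ n → ℤ.+ n / 1) (ℕ.suc B))
    (∈-applyUpTo⁺ (λ n → - (ℤ.+ n / 1)) {ℕ.suc n} {ℕ.suc B} (ℕ.s≤s (+n/1-cancel-≤ (neg-cancel-≤ -B≤x))))
  where
  neg-cancel-≤ : ∀ {p q} → - p ≤ - q → q ≤ p
  neg-cancel-≤ {p} {q} -p≤-q = subst₂ _≤_ (⁻¹-involutive q) (⁻¹-involutive p) (neg-antimono-≤ -p≤-q)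

unit-multiple-bounds : ∀ {σ x q} → σ ≡ 1ℚ ⊎ σ ≡ - 1ℚ → 0ℚ ≤ σ * x → σ * x ≤ q → - q ≤ x × x ≤ q
unit-multiple-bounds {x = x} {q} (inj₁ refl) 0≤x x≤q rewrite *-identityˡ x =
  ≤-trans (neg-antimono-≤ (≤-trans 0≤x x≤q)) 0≤x , x≤q
unit-multiple-bounds {x = x} {q} (inj₂ refl) 0≤-x -x≤q rewrite -1*x≈-x x =
  subst (- q ≤_) (⁻¹-involutive x) (neg-antimono-≤ -x≤q) ,
  ≤-trans (subst (_≤ 0ℚ) (⁻¹-involutive x) (neg-antimono-≤ 0≤-x)) (≤-trans 0≤-x -x≤q)

-- Strict homogeneous linear inequalities

p-1<p : ∀ p → p - 1ℚ < p
p-1<p p = subst₂ _<_ (+-identityˡ (p - 1ℚ)) (cancel p) (+-monoˡ-< (p - 1ℚ) (positive⁻¹ 1ℚ))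
  where
  cancel : ∀ p → 1ℚ + (p - 1ℚ) ≡ p
  cancel = solve-∀ ℚ-ring

between : (ls us : List ℚ) → (∀ {l u} → l ∈ ls → u ∈ us → l < u) → Σ ℚ λ t → All (_< t) ls × All (t <_) us
between ls us l<u = t , All.tabulate (λ l∈ → ≤-<-trans (All.lookup (xs≤max M₀ ls) l∈) M<t)
                      , All.tabulate (λ u∈ → <-≤-trans t<μ (All.lookup (min≤xs (M + 1ℚ) us) u∈))
  where
  M₀ : ℚ
  M₀ = min 0ℚ us - 1ℚ
  M : ℚ
  M = max M₀ ls
  M<us : ∀ {u} → u ∈ us → M < u
  M<us u∈ with argmax-sel id M₀ ls
  ... | inj₁ M≡M₀ = subst (_< _) (sym M≡M₀) (<-≤-trans (p-1<p (min 0ℚ us)) (All.lookup (min≤xs 0ℚ us) u∈))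
  ... | inj₂ M∈ls = l<u M∈ls u∈
  μ : ℚ
  μ = min (M + 1ℚ) us
  M<μ : M < μ
  M<μ with argmin-sel id (M + 1ℚ) us
  ... | inj₁ μ≡M+1 = subst (M <_) (sym μ≡M+1) (p<p+1 M)
  ... | inj₂ μ∈us = M<us μ∈us
  t : ℚ
  t = proj₁ (<-dense M<μ)
  M<t : M < t
  M<t = proj₁ (proj₂ (<-dense M<μ))
  t<μ : t < μ
  t<μ = proj₂ (proj₂ (<-dense M<μ))

0<-cong : ∀ {x y} → x ≡ y → 0ℚ < x ⇔ 0ℚ < y
0<-cong x≡y = mk⇔ (subst (0ℚ <_) x≡y) (subst (0ℚ <_) (sym x≡y))

x-y+y≡x : ∀ x y → (x - y) + y ≡ x
x-y+y≡x = solve-∀ ℚ-ring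

0<-⇔< : ∀ {x y} → 0ℚ < x - y ⇔ y < x
0<-⇔< {x} {y} = mk⇔
  (λ 0<x-y → subst₂ _<_ (+-identityˡ y) (x-y+y≡x x y) (+-monoˡ-< y 0<x-y))
  (λ y<x → subst (_< x - y) (+-inverseʳ y) (+-monoˡ-< (- y) y<x))

-<0⇔< : ∀ {x y} → x - y < 0ℚ ⇔ x < y
-<0⇔< {x} {y} = mk⇔
  (λ x-y<0 → subst₂ _<_ (x-y+y≡x x y) (+-identityˡ y) (+-monoˡ-< y x-y<0))
  (λ x<y → subst (x - y <_) (+-inverseʳ y) (+-monoˡ-< (- y) x<y))

0<*⇔0< : ∀ {t x} → 0ℚ < t → 0ℚ < t * x ⇔ 0ℚ < x
0<*⇔0< {t} {x} 0<t = mk⇔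
  (λ 0<tx → *-cancelˡ-<-nonNeg t {{nonNegative (<⇒≤ 0<t)}} (subst (_< t * x) (sym (*-zeroʳ t)) 0<tx))
  (λ 0<x → subst (_< t * x) (*-zeroʳ t) (*-monoʳ-<-pos t {{positive 0<t}} 0<x))

0<*⇔<0 : ∀ {t x} → t < 0ℚ → 0ℚ < t * x ⇔ x < 0ℚ
0<*⇔<0 {t} {x} t<0 = mk⇔
  (λ 0<tx → *-cancelˡ-<-nonPos t {{nonPositive (<⇒≤ t<0)}} (subst (_< t * x) (sym (*-zeroʳ t)) 0<tx))
  (λ x<0 → subst (_< t * x) (*-zeroʳ t) (*-monoʳ-<-neg t {{negative t<0}} x<0))

Feasible : ∀ {k} → List (Vecℚ k) → Set
Feasible {k} cs = Σ (Vecℚ k) λ c → All (λ a → 0ℚ < dot a c) cs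

data Bound (k : ℕ) : Set where
  lower upper free : Vecℚ k → Bound k

Satisfies : ∀ {k} → ℚ → Vecℚ k → Bound k → Set
Satisfies c₀ c (lower p) = dot p c < c₀
Satisfies c₀ c (upper n) = c₀ < dot n c
Satisfies c₀ c (free z) = 0ℚ < dot z c

threshold : ∀ {k} (a : Vecℚ (ℕ.suc k)) .{{_ : NonZero (head a)}} → Vecℚ k
threshold a j = - (1/ head a) * tail a j

dot-∷-threshold : ∀ {k} (a : Vecℚ (ℕ.suc k)) .{{_ : NonZero (head a)}} (c₀ : ℚ) (c : Vecℚ k)
  → dot a (c₀ Vector.∷ c) ≡ head a * (c₀ - dot (threshold a) c)
dot-∷-threshold a c₀ c = begin
  head a * c₀ + dot (tail a) c
    ≡⟨ cong (head a * c₀ +_) (*-identityˡ (dot (tail a) c)) ⟨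
  head a * c₀ + 1ℚ * dot (tail a) c
    ≡⟨ cong (λ s → head a * c₀ + s * dot (tail a) c) (*-inverseʳ (head a)) ⟨
  head a * c₀ + (head a * 1/ head a) * dot (tail a) c
    ≡⟨ expand (head a) c₀ (1/ head a) (dot (tail a) c) ⟨
  head a * (c₀ - - (1/ head a) * dot (tail a) c)
    ≡⟨ cong (λ s → head a * (c₀ - s)) (dot-scaleˡ (- (1/ head a)) (tail a) c) ⟨
  head a * (c₀ - dot (threshold a) c) ∎
  where
  open ≡-Reasoning
  expand : ∀ x y u d → x * (y - - u * d) ≡ x * y + (x * u) * d
  expand = solve-∀ ℚ-ring

classify : ∀ {k} → Vecℚ (ℕ.suc k) → Bound k
classify a with <-cmp (head a) 0ℚ
... | tri< a₀<0 _ _ = upper (threshold a {{neg⇒nonZero (head a) {{negative a₀<0}}}})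
... | tri≈ _ _ _ = free (tail a)
... | tri> _ _ a₀>0 = lower (threshold a {{pos⇒nonZero (head a) {{positive a₀>0}}}})

classify-sound : ∀ {k} (a : Vecℚ (ℕ.suc k)) (c₀ : ℚ) (c : Vecℚ k)
  → 0ℚ < dot a (c₀ Vector.∷ c) ⇔ Satisfies c₀ c (classify a)
classify-sound a c₀ c with <-cmp (head a) 0ℚ
... | tri< a₀<0 _ _ =
  let instance _ = neg⇒nonZero (head a) {{negative a₀<0}} in
  -<0⇔< ⇔-∘ (0<*⇔<0 a₀<0 ⇔-∘ 0<-cong (dot-∷-threshold a c₀ c))
... | tri≈ _ a₀≡0 _ =
  0<-cong (begin
    head a * c₀ + dot (tail a) c  ≡⟨ cong (λ s → s * c₀ + dot (tail a) c) a₀≡0 ⟩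
    0ℚ * c₀ + dot (tail a) c      ≡⟨ cong (_+ dot (tail a) c) (*-zeroˡ c₀) ⟩
    0ℚ + dot (tail a) c           ≡⟨ +-identityˡ (dot (tail a) c) ⟩
    dot (tail a) c                ∎)
  where open ≡-Reasoning
... | tri> _ _ a₀>0 =
  let instance _ = pos⇒nonZero (head a) {{positive a₀>0}} in
  0<-⇔< ⇔-∘ (0<*⇔0< a₀>0 ⇔-∘ 0<-cong (dot-∷-threshold a c₀ c))

lowers uppers frees : ∀ {k} → List (Bound k) → List (Vecℚ k)
lowers [] = []
lowers (lower p ∷ bs) = p ∷ lowers bs
lowers (upper _ ∷ bs) = lowers bs
lowers (free _ ∷ bs) = lowers bs
uppers [] = []
uppers (lower _ ∷ bs) = uppers bs
uppers (upper n ∷ bs) = n ∷ uppers bs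
uppers (free _ ∷ bs) = uppers bs
frees [] = []
frees (lower _ ∷ bs) = frees bs
frees (upper _ ∷ bs) = frees bs
frees (free z ∷ bs) = z ∷ frees bs

module _ {k : ℕ} (c₀ : ℚ) (c : Vecℚ k) where

  All-Satisfies⁻ : ∀ bs → All (Satisfies c₀ c) bs
    → All (λ p → dot p c < c₀) (lowers bs) × All (λ n → c₀ < dot n c) (uppers bs)
      × All (λ z → 0ℚ < dot z c) (frees bs)
  All-Satisfies⁻ [] [] = [] , [] , []
  All-Satisfies⁻ (lower p ∷ bs) (sat ∷ sats) with All-Satisfies⁻ bs sats
  ... | ls , us , zs = sat ∷ ls , us , zs
  All-Satisfies⁻ (upper n ∷ bs) (sat ∷ sats) with All-Satisfies⁻ bs sats
  ... | ls , us , zs = ls , sat ∷ us , zs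
  All-Satisfies⁻ (free z ∷ bs) (sat ∷ sats) with All-Satisfies⁻ bs sats
  ... | ls , us , zs = ls , us , sat ∷ zs

  All-Satisfies⁺ : ∀ bs → All (λ p → dot p c < c₀) (lowers bs) → All (λ n → c₀ < dot n c) (uppers bs)
    → All (λ z → 0ℚ < dot z c) (frees bs) → All (Satisfies c₀ c) bs
  All-Satisfies⁺ [] _ _ _ = []
  All-Satisfies⁺ (lower p ∷ bs) (sat ∷ ls) us zs = sat ∷ All-Satisfies⁺ bs ls us zs
  All-Satisfies⁺ (upper n ∷ bs) ls (sat ∷ us) zs = sat ∷ All-Satisfies⁺ bs ls us zs
  All-Satisfies⁺ (free z ∷ bs) ls us (sat ∷ zs) = sat ∷ All-Satisfies⁺ bs ls us zs

-- Fourier–Motzkin elimination of the first variable.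
eliminate : ∀ {k} → List (Vecℚ (ℕ.suc k)) → List (Vecℚ k)
eliminate cs = frees bs ++ cartesianProductWith _⊖_ (uppers bs) (lowers bs)
  where
  bs : List (Bound _)
  bs = map classify cs

eliminate-complete : ∀ {k} (cs : List (Vecℚ (ℕ.suc k))) → Feasible cs → Feasible (eliminate cs)
eliminate-complete cs (c , sat)
  with All-Satisfies⁻ (head c) (tail c) (map classify cs)
         (All.map⁺ (All.map (λ {a} → Equivalence.to (classify-sound a (head c) (tail c))) sat))
... | lowers-sat , uppers-sat , frees-sat = tail c , All.++⁺ frees-sat
  (All.cartesianProductWith⁺ (setoid _) (setoid _) _⊖_ _ _ λ {n} {p} n∈ p∈ →
    subst (0ℚ <_) (sym (dot-⊖ n p (tail c)))
      (Equivalence.from 0<-⇔< (<-trans (All.lookup lowers-sat p∈) (All.lookup uppers-sat n∈))))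

eliminate-sound : ∀ {k} (cs : List (Vecℚ (ℕ.suc k))) → Feasible (eliminate cs) → Feasible cs
eliminate-sound {k} cs (c , sat) =
  c₀ Vector.∷ c , All.map (λ {a} → Equivalence.from (classify-sound a c₀ c)) (All.map⁻ bs-sat)
  where
  bs : List (Bound k)
  bs = map classify cs
  frees-sat : All (λ z → 0ℚ < dot z c) (frees bs)
  frees-sat = proj₁ (All.++⁻ (frees bs) sat)
  pairs-sat : All (λ a → 0ℚ < dot a c) (cartesianProductWith _⊖_ (uppers bs) (lowers bs))
  pairs-sat = proj₂ (All.++⁻ (frees bs) sat)
  separated : ∀ {l u} → l ∈ map (λ p → dot p c) (lowers bs) → u ∈ map (λ n → dot n c) (uppers bs) → l < u
  separated l∈ u∈ with ∈-map⁻ (λ p → dot p c) l∈ | ∈-map⁻ (λ n → dot n c) u∈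
  ... | p , p∈ , refl | n , n∈ , refl =
    Equivalence.to 0<-⇔< (subst (0ℚ <_) (dot-⊖ n p c) (All.lookup pairs-sat (∈-cartesianProductWith⁺ _⊖_ n∈ p∈)))
  gap : Σ ℚ λ t → All (_< t) (map (λ p → dot p c) (lowers bs)) × All (t <_) (map (λ n → dot n c) (uppers bs))
  gap = between _ _ separated
  c₀ : ℚ
  c₀ = proj₁ gap
  bs-sat : All (Satisfies c₀ c) bs
  bs-sat = All-Satisfies⁺ c₀ c bs (All.map⁻ (proj₁ (proj₂ gap))) (All.map⁻ (proj₂ (proj₂ gap))) frees-sat

feasible? : ∀ {k} (cs : List (Vecℚ k)) → Dec (Feasible cs)
feasible? {ℕ.zero} [] = yes ((λ ()) , [])
feasible? {ℕ.zero} (a ∷ cs) = no λ { (_ , 0<0 ∷ _) → <-irrefl refl 0<0 }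
feasible? {ℕ.suc k} cs = map′ (eliminate-sound cs) (eliminate-complete cs) (feasible? (eliminate cs))

-- Directions with prescribed signs

SignedDirection : ∀ {m} → Gens m → (Fin m → ℚ) → Set
SignedDirection {m} V σ = Σ (Vecℚ m) λ v → Span V v × (∀ i → ¬ Perp (Span V) (e i) → 0ℚ < σ i * v i)

signed-direction? : ∀ {m} (V : Gens m) (σ : Fin m → ℚ) → Dec (SignedDirection V σ)
signed-direction? {m} V@(k , g) σ = map′ from-feasible to-feasible (feasible? rows)
  where
  row : Fin m → Vecℚ k
  row i j = σ i * g j i
  active? : ∀ i → Dec (¬ Perp (Span V) (e i))
  active? i = ¬? (e-perp? V i)
  rows : List (Vecℚ k)
  rows = map row (filter active? (allFin m))
  combination : Vecℚ k → Vecℚ m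
  combination c i = sumFin (λ j → c j * g j i)
  dot-row : ∀ i c → dot (row i) c ≡ σ i * combination c i
  dot-row i c = begin
    sumFin (λ j → σ i * g j i * c j)    ≡⟨ sumFin-cong (λ j → rearrange (σ i) (g j i) (c j)) ⟩
    sumFin (λ j → σ i * (c j * g j i))  ≡⟨ *-distribˡ-sumFin (σ i) (λ j → c j * g j i) ⟨
    σ i * combination c i               ∎
    where
    open ≡-Reasoning
    rearrange : ∀ s x y → s * x * y ≡ s * (y * x)
    rearrange = solve-∀ ℚ-ring
  from-feasible : Feasible rows → SignedDirection V σ
  from-feasible (c , sat) = combination c , (c , λ _ → refl) , λ i ¬⊥ →
    subst (0ℚ <_) (dot-row i c) (All.lookup sat (∈-map⁺ row (∈-filter⁺ active? (∈-allFin i) ¬⊥)))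
  to-feasible : SignedDirection V σ → Feasible rows
  to-feasible (v , (c , v≐) , σv>0) = c , All.tabulate row-sat
    where
    row-sat : ∀ {a} → a ∈ rows → 0ℚ < dot a c
    row-sat a∈ with ∈-map⁻ row a∈
    ... | i , i∈ , refl = subst (0ℚ <_) (sym (dot-row i c))
      (subst (λ w → 0ℚ < σ i * w) (v≐ i) (σv>0 i (proj₂ (∈-filter⁻ active? {xs = allFin m} i∈))))

¬¬-pull-Fin : ∀ {n} {P : Fin n → Set} → (∀ i → ¬ ¬ P i) → ¬ ¬ (∀ i → P i)
¬¬-pull-Fin {ℕ.zero} ¬¬P = λ ¬∀P → ¬∀P λ ()
¬¬-pull-Fin {ℕ.suc n} ¬¬P ¬∀P =
  ¬¬P zero λ P₀ → ¬¬-pull-Fin (¬¬P ∘ suc) λ P₊ → ¬∀P λ { zero → P₀ ; (suc i) → P₊ i }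

module _ {m : ℕ} (V : Gens m) (a : Vecℚ m) (σ : Fin m → ℚ) (σ-unit : ∀ i → σ i ≡ 1ℚ ⊎ σ i ≡ - 1ℚ)
  (Y : Subset m) (Y⊆A : Y ⊆ affine a V) (Y-int : ∀ y → Y y → ∀ i → IsInt (y i))
  (Y-signed : ∀ y → Y y → ∀ i → 0ℚ ≤ σ i * y i) (V⊆vsaffY : Span V ⊆ vsaff Y) where

  unbounded : ∀ i → ¬ Perp (Span V) (e i) → ∀ q → ¬ ¬ Σ (Vecℚ m) λ y → Y y × q < σ i * y i
  unbounded i ¬⊥ q none-beyond = ¬⊥ λ x x∈V →
    trans (dot-e i x) (finitely-valued⇒vsaff-coordinate≡0 i (integers-within B) within x (V⊆vsaffY x x∈V))
    where
    B : ℕ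
    B = ℤ.∣ ↥ q ∣
    within : ∀ y → Y y → y i ∈ integers-within B
    within y Yy with unit-multiple-bounds (σ-unit i) (Y-signed y Yy i) (≮⇒≥ λ q<σyᵢ → none-beyond (y , Yy , q<σyᵢ))
    ... | -q≤yᵢ , yᵢ≤q = IsInt⇒∈-integers-within B (Y-int y Yy i)
      (≤-trans (neg-antimono-≤ (≤-∣numerator∣ q)) -q≤yᵢ) (≤-trans yᵢ≤q (≤-∣numerator∣ q))

  -- The bound m·σᵢ·y₀[i] is written as a sum so that it cancels against v = Σᵢ (yᵢ − y₀).
  FarPoint : Vecℚ m → Fin m → Set
  FarPoint y₀ i = Σ (Vecℚ m) λ y → Y y × (¬ Perp (Span V) (e i) → sumFin {m} (λ _ → σ i * y₀ i) < σ i * y i)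

  far-point : ∀ y₀ → Y y₀ → ∀ i → ¬ ¬ FarPoint y₀ i
  far-point y₀ Yy₀ i with e-perp? V i
  ... | yes ⊥ᵢ = λ no-point → no-point (y₀ , Yy₀ , contradiction ⊥ᵢ)
  ... | no ¬⊥ᵢ = ¬¬-map (λ (y , Yy , beyond) → y , Yy , λ _ → beyond) (unbounded i ¬⊥ᵢ _)

  far-points⇒signed-direction : ∀ y₀ → Y y₀ → (∀ i → FarPoint y₀ i) → SignedDirection V σ
  far-points⇒signed-direction y₀ Yy₀ far = v , v∈V , σv>0
    where
    y : Fin m → Vecℚ m
    y i = proj₁ (far i)
    Yy : ∀ i → Y (y i)
    Yy i = proj₁ (proj₂ (far i))
    v : Vecℚ m
    v l = sumFin (λ i → (y i ⊖ y₀) l)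
    v∈V : Span V v
    v∈V = span-sumFin (λ i → y i ⊖ y₀) (λ i → affine-diff {a = a} (Y⊆A _ (Yy i)) (Y⊆A _ Yy₀))
    σv≡ : ∀ j → σ j * v j ≡ sumFin (λ i → σ j * y i j) - sumFin {m} (λ _ → σ j * y₀ j)
    σv≡ j = begin
      σ j * sumFin (λ i → y i j - y₀ j)
        ≡⟨ *-distribˡ-sumFin (σ j) (λ i → y i j - y₀ j) ⟩
      sumFin (λ i → σ j * (y i j - y₀ j))
        ≡⟨ sumFin-cong (λ i → x[y-z]≈xy-xz (σ j) (y i j) (y₀ j)) ⟩
      sumFin (λ i → σ j * y i j - σ j * y₀ j)
        ≡⟨ sumFin-distrib-- (λ i → σ j * y i j) (λ _ → σ j * y₀ j) ⟩
      sumFin (λ i → σ j * y i j) - sumFin {m} (λ _ → σ j * y₀ j) ∎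
      where open ≡-Reasoning
    σv>0 : ∀ j → ¬ Perp (Span V) (e j) → 0ℚ < σ j * v j
    σv>0 j ¬⊥ = subst (0ℚ <_) (sym (σv≡ j)) (Equivalence.from 0<-⇔<
      (<-≤-trans (proj₂ (proj₂ (far j)) ¬⊥) (term≤sumFin (λ i → Y-signed (y i) (Yy i) j) j)))

  ¬¬signed-direction : ¬ ¬ SignedDirection V σ
  ¬¬signed-direction = do
    y₀ , Yy₀ ← vsaff⇒¬¬inhabited (V⊆vsaffY _ (span-0 V))
    far ← ¬¬-pull-Fin (far-point y₀ Yy₀)
    pure (far-points⇒signed-direction y₀ Yy₀ far)
    where open RawMonad ¬¬-Monad

  signed-direction : SignedDirection V σ
  signed-direction = decidable-stable (signed-direction? V σ) ¬¬signed-direction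

-- The sign s prescribes: s i ≡ 0 asks for x[i] ≥ 0, and s i ≡ r ∸ 1, nonzero as r ≥ 2, for x[i] < 0.
orientation : ℕ → ℚ
orientation ℕ.zero = 1ℚ
orientation (ℕ.suc _) = - 1ℚ

orientation-unit : ∀ n → orientation n ≡ 1ℚ ⊎ orientation n ≡ - 1ℚ
orientation-unit ℕ.zero = inj₁ refl
orientation-unit (ℕ.suc _) = inj₂ refl

Z⇒0≤orientation* : ∀ {r m s} → (∀ i → s i ≡ 0 ⊎ s i ≡ r ∸ 1)
  → ∀ {y} → Z r m s y → ∀ i → 0ℚ ≤ orientation (s i) * y i
Z⇒0≤orientation* {s = s} s-values {y} y∈Z i with s i | s-values i | y∈Z i
... | ℕ.zero | _ | _ , 0≤yᵢ , _ = subst (0ℚ ≤_) (sym (*-identityˡ (y i))) (0≤yᵢ refl)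
... | ℕ.suc _ | inj₂ sᵢ≡r-1 | _ , _ , yᵢ<0 =
  subst (0ℚ ≤_) (sym (-1*x≈-x (y i))) (neg-antimono-≤ (<⇒≤ (yᵢ<0 sᵢ≡r-1)))

0<orientation*⇒sign-conditions : ∀ {r n x} → r ≥ 2 → 0ℚ < orientation n * x
  → (n ≡ r ∸ 1 → x < 0ℚ) × (n ≡ 0 → 0ℚ < x)
0<orientation*⇒sign-conditions {n = ℕ.zero} {x} (ℕ.s≤s (ℕ.s≤s _)) 0<x =
  (λ ()) , λ _ → subst (0ℚ <_) (*-identityˡ x) 0<x
0<orientation*⇒sign-conditions {n = ℕ.suc _} _ 0<-x =
  (λ _ → Equivalence.to (0<*⇔<0 (negative⁻¹ (- 1ℚ))) 0<-x) , λ ()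

mainTheorem4 : (r m : ℕ) → r ≥ 2 → m ≥ 1 → (V : Gens m) → (a : Vecℚ m)
    → (s : Fin m → ℕ) → (∀ i → s i ≡ 0 ⊎ s i ≡ r ∸ 1)
    → Span V ⊆ vsaff (Z r m s ∩ affine a V)
    → Σ (Vecℚ m) λ v → Span V v
        × (∀ i → ¬ Perp (Span V) (e i)
             → (s i ≡ r ∸ 1 → v i < 0ℚ) × (s i ≡ 0 → 0ℚ < v i))
mainTheorem4 r m r≥2 _ V a s s-values V⊆vsaff =
  let v , v∈V , 0<σv = signed-direction V a (orientation ∘ s) (orientation-unit ∘ s) (Z r m s ∩ affine a V)
                         (λ _ → proj₂) (λ y y∈Y i → proj₁ (proj₁ y∈Y i))
                         (λ y y∈Y → Z⇒0≤orientation* {r} s-values (proj₁ y∈Y)) V⊆vsaff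
  in v , v∈V , λ i ¬⊥ → 0<orientation*⇒sign-conditions r≥2 (0<σv i ¬⊥)
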